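{- Given $F\in \mathcal{G}_{N}^{dif}(A)$, the left substitutional inverse of $F$ is given by the power series $G(z)$, where $g_{v}^{j}=\langle S_{\mathcal{L}}(Y_{v}^{j}),F\rangle$ and $S_{\mathcal{L}}=\mathbf{s}S_{\mathcal{H}}\mathbf{s}$ is the antipode of the left Lagrange Hopf algebra $\mathcal{L}^{N}$. The right substitutional inverse of $F$ is given by $H(z)$, where $h_{v}^{j}=\langle S_{\mathcal{R}}(Y_{v}^{j}),F\rangle$, and $S_{\mathcal{R}}=\mathbf{t}S_{\mathcal{H}}\mathbf{t}$ is the antipode of the right Lagrange Hopf algebra $\mathcal{R}^{N}$.
   Context: Let $A$ be a non-commutative unital algebra and $z_{1},\ldots,z_{N}$ non-commuting variables which commute with elements of $A$. For a word $w=w(1)\cdots w(p)$ in the free monoid on $\{1,\ldots,N\}$ put $z_{w}=z_{w(1)}\cdots z_{w(p)}$. Let $\mathcal{G}_{N}^{dif}(A)$ be the set of $N$-tuples $F=(F^{1},\ldots,F^{N})$ of power series $F^{j}(z)=z_{j}+\sum_{|u|\geq 2}f_{u}^{j}z_{u}$ with $f_{u}^{j}\in A$. For $F,G\in\mathcal{G}_{N}^{dif}(A)$, $F\circ G$ denotes the series obtained by substituting $G^{j}(z)$ for $z_{j}$ in $F$; explicitly $(F\circ G)^{i}_{u}=\sum f_{w}^{i}g_{u|C_{1}}^{w(1)}\cdots g_{u|C_{q}}^{w(q)}$, summed over all interval (ordered) partitions $(C_{1},\ldots,C_{q})$ of $(1,\ldots,|u|)$ and colorings $w=w(1)\cdots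 w(q)$ of the blocks (with $f^{i}_{j}=\delta_{ij}$, and a singleton block must carry the color of its element). $G$ is a left (resp. right) substitutional inverse of $F$ if $G\circ F$ (resp. $F\circ G$) equals the identity tuple $(z_{1},\ldots,z_{N})$. Let $\mathcal{H}=\mathcal{H}^{N}$ be the free unital algebra on generators $Y_{u}^{i}$ ($1\leq i\leq N$, $|u|\geq 2$), with the convention $Y_{j}^{i}=\delta_{ij}1$, coproduct $\Delta(Y_{u}^{i})=\sum_{q}\sum_{(C_{1},\ldots,C_{q})}\sum_{v}Y_{u|C_{1}}^{v(1)}\cdots Y_{u|C_{q}}^{v(q)}\otimes Y_{v}^{i}$ (sum over interval partitions of $(1,\ldots,|u|)$ and words $v$ of length $q$), counit $\varepsilon(Y_{u}^{i})=0$, and antipode $S_{\mathcal{H}}$ (the interval partition incidence Hopf algebra). Let $\mathbf{s}$ be the involutive anti-automorphism of $\mathcal{H}$ with $\mathbf{s}(Y_{u}^{i})=Y_{u^{*}}^{i}$, where $u^{*}$ is the reversed word, and $\mathbf{t}$ the involutive anti-automorphism with $\mathbf{t}(Y_{u}^{i})=Y_{u}^{i}$. The left Lagrange Hopf algebra $\mathcal{L}^{N}$ is $\mathcal{H}$ with the opposite coproduct and antipode $S_{\mathcal{L}}=S_{\mathcal{H}}^{ -1}=\mathbf{s}S_{\mathcal{H}}\mathbf{s}$; the right Lagrange Hopf algebra $\mathcal{R}^{N}$ is the $\mathbf{t}$-transformed Hopf algebra, with antipode $S_{\mathcal{R}}=\mathbf{t}S_{\mathcal{H}}\mathbf{t}$.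 The pairing $\langle\,,\rangle:\mathcal{H}\times\mathcal{G}_{N}^{dif}(A)\to A$ is the bilinear map defined by $\langle Y_{u_{1}}^{i_{1}}\cdots Y_{u_{q}}^{i_{q}},F\rangle=f_{u_{1}}^{i_{1}}\cdots f_{u_{q}}^{i_{q}}$ (in particular $\langle Y_{u}^{i},F\rangle=f_{u}^{i}$, $\langle 1,F\rangle=1$), extended linearly; it satisfies $\langle ab,F\rangle=\langle a,F\rangle\langle b,F\rangle$ and $\langle Y_{u}^{i},F\circ G\rangle=m_{A}\langle\Delta^{op}(Y_{u}^{i}),F\otimes G\rangle$. -}

module Defs where

open import Level using (Level)
open import Data.Bool using (Bool; true; false; not; _xor_; if_then_else_)
open import Data.Nat using (ℕ; zero; suc; _<ᵇ_; _≤_)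
open import Data.Fin using (Fin)
open import Data.Fin.Properties using (_≟_)
open import Data.Product using (_×_; _,_)
open import Data.List using (List; []; _∷_; [_]; _++_; map; concatMap; foldr; zipWith; reverse; length; allFin; filterᵇ)
open import Relation.Nullary using (does)
open import Algebra.Bundles using (Ring)

Word : ℕ → Set
Word N = List (Fin N)

wordsOf : (N : ℕ) → ℕ → List (Word N)
wordsOf N zero    = [] ∷ []
wordsOf N (suc q) = concatMap (λ i → map (i ∷_) (wordsOf N q)) (allFin N)

-- all interval (ordered) partitions of a list into nonempty consecutive blocks
-- (represented by the list of blocks u|C₁, …, u|C_q)
private
  extendSplit : {X : Set} → X → List (List X) → List (List (List X))
  extendSplit x []       = ([ x ] ∷ []) ∷ []
  extendSplit x (b ∷ bs) = ([ x ] ∷ b ∷ bs) ∷ ((x ∷ b) ∷ bs) ∷ []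

intervalPartitions : {X : Set} → List X → List (List (List X))
intervalPartitions []       = [] ∷ []
intervalPartitions (x ∷ xs) = concatMap (extendSplit x) (intervalPartitions xs)

module Series {c ℓ : Level} (A : Ring c ℓ) where
  open Ring A

  Σ' : List Carrier → Carrier
  Σ' = foldr _+_ 0#

  Π' : List Carrier → Carrier
  Π' = foldr _*_ 1#

  -- An element F ∈ G^dif_N(A) is given by its coefficients f^j_u for |u| ≥ 2;
  -- the value of the function on words of length < 2 is ignored (see coeff).
  Ser : ℕ → Set c
  Ser N = Fin N → Word N → Carrier

  δ : {N : ℕ} → Fin N → Fin N → Carrier
  δ i j = if does (i ≟ j) then 1# else 0#

  -- full coefficient of z_u in F^i : 0 for the empty word, δ for letters
  coeff : {N : ℕ} → Ser N → Fin N → Word N → Carrier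
  coeff F i []          = 0#
  coeff F i (j ∷ [])    = δ i j
  coeff F i u@(_ ∷ _ ∷ _) = F i u

  -- substitution F ∘ G (substitute G^j for z_j in F):
  -- (F∘G)^i_u = Σ_{(C₁..C_q)} Σ_{w, |w|=q} f^i_w g^{w(1)}_{u|C₁} ⋯ g^{w(q)}_{u|C_q}
  _∘ˢ_ : {N : ℕ} → Ser N → Ser N → Ser N
  _∘ˢ_ {N} F G i u =
    Σ' (concatMap (λ p → map (λ w → coeff F i w * Π' (zipWith (coeff G) w p))
                             (wordsOf N (length p)))
                  (intervalPartitions u))

  -- the identity tuple (z₁,…,z_N): all coefficients of degree ≥ 2 vanish
  idSer : {N : ℕ} → Ser N
  idSer i u = 0#

  _≋_ : {N : ℕ} → Ser N → Ser N → Set ℓ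
  _≋_ {N} F G = (i : Fin N) (u : Word N) → 2 ≤ length u → F i u ≈ G i u

-- The free algebra H^N over ℤ on generators Y^i_u, as formal ℤ-linear
-- combinations of monomials (each term a sign and a monomial; a list of
-- terms is their sum; coefficient n is encoded by repeating a term).

Gen : ℕ → Set
Gen N = Fin N × Word N

Mono : ℕ → Set
Mono N = List (Gen N)

HElt : ℕ → Set
HElt N = List (Bool × Mono N)   -- true = +, false = −

module FreeAlg {N : ℕ} where
  zeroH : HElt N
  zeroH = []

  oneH : HElt N
  oneH = (true , []) ∷ []

  _+H_ : HElt N → HElt N → HElt N
  _+H_ = _++_

  negH : HElt N → HElt N
  negH = map (λ { (s , m) → (not s , m) })

  _*H_ : HElt N → HElt N → HElt N
  a *H b = concatMap (λ { (s , m) → map (λ { (s' , m') → (not (s xor s') , m ++ m') }) b }) a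

  ΠH : List (HElt N) → HElt N
  ΠH = foldr _*H_ oneH

  sumH : List (HElt N) → HElt N
  sumH = foldr _+H_ zeroH

  gen : Fin N → Word N → HElt N
  gen i u = (true , (i , u) ∷ []) ∷ []

  Y : Fin N → Word N → HElt N
  Y i (j ∷ []) = if does (i ≟ j) then oneH else zeroH
  Y i u        = gen i u

  -- Antipode of H on generators, determined by m(id ⊗ S_H)Δ = ηε:
  --   Σ_{(C),v} Y^{v(1)}_{u|C₁} ⋯ Y^{v(q)}_{u|C_q} S_H(Y^i_v) = 0  (|u| ≥ 2),
  -- whose q = |u| part is S_H(Y^i_u), hence
  --   S_H(Y^i_u) = − Σ_{q<|u|} Σ_{(C),v} Y^{v(1)}_{u|C₁} ⋯ Y^{v(q)}_{u|C_q} S_H(Y^i_v).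
  -- First argument is fuel (called with |u|; always sufficient).
  SgenF : ℕ → Fin N → Word N → HElt N
  SgenF _       i (j ∷ []) = Y i (j ∷ [])
  SgenF zero    i u        = zeroH
  SgenF (suc n) i u =
    negH (sumH (concatMap
      (λ p → map (λ v → ΠH (zipWith Y v p) *H SgenF n i v) (wordsOf N (length p)))
      (filterᵇ (λ p → length p <ᵇ length u) (intervalPartitions u))))

  Sgen : Gen N → HElt N
  Sgen (i , u) = SgenF (length u) i u

  SMono : Mono N → HElt N
  SMono []      = oneH
  SMono (g ∷ m) = SMono m *H Sgen g

  SH : HElt N → HElt N
  SH = concatMap (λ { (s , m) → if s then SMono m else negH (SMono m) })

  sH : HElt N → HElt N
  sH = map (λ { (s , m) → (s , reverse (map (λ { (i , u) → (i , reverse u) }) m)) })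

  tH : HElt N → HElt N
  tH = map (λ { (s , m) → (s , reverse m) })

  SL : HElt N → HElt N
  SL x = sH (SH (sH x))

  SR : HElt N → HElt N
  SR x = tH (SH (tH x))

module Pairing {c ℓ : Level} (A : Ring c ℓ) where
  open Ring A
  open Series A

  pairMono : {N : ℕ} → Mono N → Ser N → Carrier
  pairMono m F = Π' (map (λ { (i , u) → coeff F i u }) m)

  ⟨_,_⟩ : {N : ℕ} → HElt N → Ser N → Carrier
  ⟨ x , F ⟩ = Σ' (map (λ { (s , m) → if s then pairMono m F else - pairMono m F }) x)

  leftInvSer : {N : ℕ} → Ser N → Ser N
  leftInvSer F j v = ⟨ FreeAlg.SL (FreeAlg.gen j v) , F ⟩

  rightInvSer : {N : ℕ} → Ser N → Ser N
  rightInvSer F j v = ⟨ FreeAlg.SR (FreeAlg.gen j v) , F ⟩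

module Submission where

-- Pairing with F is a ring homomorphism from the free algebra H to A, so the recursion that
-- defines the antipode, Σ Y^{v(1)}_{u|C₁} ⋯ Y^{v(q)}_{u|C_q} S_H(Y^i_v) = 0, becomes an identity
-- Σ f^{v(1)}_{u|C₁} ⋯ f^{v(q)}_{u|C_q} ψ^i_v = δ for ψ^i_v = ⟨S_H(Y^i_v), F⟩: a substitution
-- in which the outer coefficient stands on the right, i.e. a substitution in the opposite ring.
-- Since t only reverses monomials, pairing with t x in A is pairing with x in Aᵒᵖ; s moreover
-- reverses the words u.  For S_L = s S_H s the identity, read along the reversed word, is
-- G ∘ F = id.  For S_R = t S_H t one needs more: precomposition g ↦ Σ f ⋯ f g is unitriangular,
-- hence injective, and the antipode identity makes h ↦ Σ ψ ⋯ ψ h (products reversed) a right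
-- inverse of it, hence also a left inverse; applied to the coefficients of F this is F ∘ H = id.

open import Defs
open import Level using (Level)
open import Data.Nat using (ℕ; zero; suc; _≤_; _<_; _<ᵇ_; s≤s; z≤n)
open import Data.Nat.Properties using (suc-injective; <ᵇ⇒<; <⇒<ᵇ; ≤-trans; ≤-pred; ≤-refl; m≤n⇒m≤1+n)
open import Data.Product using (_×_; _,_; map₁; uncurry)
open import Data.Bool using (Bool; true; false; not; _xor_; if_then_else_)
open import Data.Fin using (Fin) renaming (zero to fzero; suc to fsuc)
open import Data.Fin.Properties using (_≟_)
open import Relation.Nullary using (does)
open import Relation.Nullary.Decidable using (T?)
open import Data.List using (List; []; _∷_; [_]; _++_; map; concatMap; length; allFin; zipWith; filterᵇ; reverse)
open import Data.List.Properties
  using (concatMap-cong; map-++; map-id; map-tabulate; unfold-reverse; reverse-++; reverse-involutive; length-reverse; length-map)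
open import Data.List.Relation.Unary.All as All using (All; []; _∷_)
open import Data.List.Relation.Unary.All.Properties using (map⁺; concat⁺; all-filter)
open import Algebra.Bundles using (Ring)
import Algebra.Properties.Ring as RingProperties
import Algebra.Properties.CommutativeSemigroup as CommutativeSemigroupProperties
import Algebra.Construct.Flip.Op as Op
open import Relation.Binary.PropositionalEquality as P using (_≡_)

module Sums {c ℓ : Level} (R : Ring c ℓ) where
  open Ring R
  open RingProperties R using (-‿+-comm; -0#≈0#)
  open CommutativeSemigroupProperties +-commutativeSemigroup using (interchange)
  open Series R using (Σ'; Π'; δ)

  ∑ : {X : Set} → List X → (X → Carrier) → Carrier
  ∑ xs f = Σ' (map f xs)

  syntax ∑ xs (λ x → e) = ∑[ x ∈ xs ] e

  Σ'-++ : (xs ys : List Carrier) → Σ' (xs ++ ys) ≈ Σ' xs + Σ' ys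
  Σ'-++ []       ys = sym (+-identityˡ _)
  Σ'-++ (x ∷ xs) ys = trans (+-congˡ (Σ'-++ xs ys)) (sym (+-assoc _ _ _))

  Π'-++ : (xs ys : List Carrier) → Π' (xs ++ ys) ≈ Π' xs * Π' ys
  Π'-++ []       ys = sym (*-identityˡ _)
  Π'-++ (x ∷ xs) ys = trans (*-congˡ (Π'-++ xs ys)) (sym (*-assoc _ _ _))

  ∑-++ : {X : Set} (xs ys : List X) (f : X → Carrier) → ∑ (xs ++ ys) f ≈ ∑ xs f + ∑ ys f
  ∑-++ xs ys f = trans (reflexive (P.cong Σ' (map-++ f xs ys))) (Σ'-++ (map f xs) (map f ys))

  ∑-cong : {X : Set} (xs : List X) {f g : X → Carrier} → (∀ x → f x ≈ g x) → ∑ xs f ≈ ∑ xs g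
  ∑-cong []       f≈g = refl
  ∑-cong (x ∷ xs) f≈g = +-cong (f≈g x) (∑-cong xs f≈g)

  ∑-cong-All : {X : Set} {xs : List X} {f g : X → Carrier} → All (λ x → f x ≈ g x) xs → ∑ xs f ≈ ∑ xs g
  ∑-cong-All []           = refl
  ∑-cong-All (fx≈gx ∷ es) = +-cong fx≈gx (∑-cong-All es)

  ∑-+ : {X : Set} (xs : List X) (f g : X → Carrier) → ∑[ x ∈ xs ] (f x + g x) ≈ ∑ xs f + ∑ xs g
  ∑-+ []       f g = sym (+-identityˡ _)
  ∑-+ (x ∷ xs) f g = trans (+-congˡ (∑-+ xs f g)) (interchange _ _ _ _)

  ∑-zero : {X : Set} (xs : List X) {f : X → Carrier} → (∀ x → f x ≈ 0#) → ∑ xs f ≈ 0#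
  ∑-zero []       f≈0 = refl
  ∑-zero (x ∷ xs) f≈0 = trans (+-cong (f≈0 x) (∑-zero xs f≈0)) (+-identityˡ _)

  ∑-neg : {X : Set} (xs : List X) (f : X → Carrier) → ∑[ x ∈ xs ] (- f x) ≈ - ∑ xs f
  ∑-neg []       f = sym -0#≈0#
  ∑-neg (x ∷ xs) f = trans (+-congˡ (∑-neg xs f)) (-‿+-comm _ _)

  *-distribˡ-∑ : {X : Set} (a : Carrier) (xs : List X) (f : X → Carrier) → a * ∑ xs f ≈ ∑[ x ∈ xs ] (a * f x)
  *-distribˡ-∑ a []       f = zeroʳ a
  *-distribˡ-∑ a (x ∷ xs) f = trans (distribˡ a _ _) (+-congˡ (*-distribˡ-∑ a xs f))

  *-distribʳ-∑ : {X : Set} (a : Carrier) (xs : List X) (f : X → Carrier) → ∑ xs f * a ≈ ∑[ x ∈ xs ] (f x * a)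
  *-distribʳ-∑ a []       f = zeroˡ a
  *-distribʳ-∑ a (x ∷ xs) f = trans (distribʳ a _ _) (+-congˡ (*-distribʳ-∑ a xs f))

  ∑-comm : {X Y : Set} (xs : List X) (ys : List Y) (f : X → Y → Carrier) →
           ∑[ x ∈ xs ] ∑[ y ∈ ys ] f x y ≈ ∑[ y ∈ ys ] ∑[ x ∈ xs ] f x y
  ∑-comm []       ys f = sym (∑-zero ys (λ _ → refl))
  ∑-comm (x ∷ xs) ys f = trans (+-congˡ (∑-comm xs ys f)) (sym (∑-+ ys (f x) _))

  ∑-map : {X Y : Set} (g : Y → X) (ys : List Y) (f : X → Carrier) → ∑ (map g ys) f ≈ ∑[ y ∈ ys ] f (g y)
  ∑-map g []       f = refl
  ∑-map g (y ∷ ys) f = +-congˡ (∑-map g ys f)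

  ∑-concatMap : {X Y : Set} (g : Y → List X) (ys : List Y) (f : X → Carrier) →
                ∑ (concatMap g ys) f ≈ ∑[ y ∈ ys ] ∑ (g y) f
  ∑-concatMap g []       f = refl
  ∑-concatMap g (y ∷ ys) f = trans (∑-++ (g y) _ f) (+-congˡ (∑-concatMap g ys f))

  Σ'-concatMap-map : {Y Z : Set} (g : Y → List Z) (h : Y → Z → Carrier) (ys : List Y) →
                     Σ' (concatMap (λ y → map (h y) (g y)) ys) ≈ ∑[ y ∈ ys ] ∑ (g y) (h y)
  Σ'-concatMap-map g h []       = refl
  Σ'-concatMap-map g h (y ∷ ys) = trans (Σ'-++ (map (h y) (g y)) _) (+-congˡ (Σ'-concatMap-map g h ys))

  ∑-filterᵇ : {X : Set} (b : X → Bool) (xs : List X) (f : X → Carrier) →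
              ∑ xs f ≈ ∑ (filterᵇ b xs) f + ∑[ x ∈ xs ] (if b x then 0# else f x)
  ∑-filterᵇ b []       f = sym (+-identityˡ _)
  ∑-filterᵇ b (x ∷ xs) f with b x
  ... | true  = trans (+-congˡ (∑-filterᵇ b xs f))
                      (trans (sym (+-assoc _ _ _)) (+-congˡ (sym (+-identityˡ _))))
  ... | false = trans (+-congˡ (∑-filterᵇ b xs f))
                      (trans (sym (+-assoc _ _ _)) (trans (+-congʳ (+-comm _ _)) (+-assoc _ _ _)))

  ∑-allFin-suc : (n : ℕ) (f : Fin (suc n) → Carrier) →
                 ∑ (allFin (suc n)) f ≈ f fzero + ∑[ j ∈ allFin n ] f (fsuc j)
  ∑-allFin-suc n f = +-congˡ (trans (reflexive (P.cong (λ js → ∑ js f) (P.sym (map-tabulate (λ i → i) fsuc))))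
                                    (∑-map fsuc (allFin n) f))

  ∑-δˡ : (n : ℕ) (x : Fin n) (h : Fin n → Carrier) → ∑[ j ∈ allFin n ] (δ j x * h j) ≈ h x
  ∑-δˡ (suc n) x h = trans (∑-allFin-suc n _) (split x)
    where
    split : (x : Fin (suc n)) → δ fzero x * h fzero + ∑[ j ∈ allFin n ] (δ (fsuc j) x * h (fsuc j)) ≈ h x
    split fzero    = trans (+-cong (*-identityˡ _) (∑-zero (allFin n) (λ j → zeroˡ _))) (+-identityʳ _)
    split (fsuc x) = trans (+-cong (zeroˡ _) (∑-δˡ n x (λ j → h (fsuc j)))) (+-identityˡ _)

  ∑-δʳ : (n : ℕ) (x : Fin n) (h : Fin n → Carrier) → ∑[ j ∈ allFin n ] (h j * δ x j) ≈ h x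
  ∑-δʳ (suc n) x h = trans (∑-allFin-suc n _) (split x)
    where
    split : (x : Fin (suc n)) → h fzero * δ x fzero + ∑[ j ∈ allFin n ] (h (fsuc j) * δ x (fsuc j)) ≈ h x
    split fzero    = trans (+-cong (*-identityʳ _) (∑-zero (allFin n) (λ j → zeroʳ _))) (+-identityʳ _)
    split (fsuc x) = trans (+-cong (zeroʳ _) (∑-δʳ n x (λ j → h (fsuc j)))) (+-identityˡ _)

prefixSplits : {X : Set} → List X → List (List X × List X)
prefixSplits []       = []
prefixSplits (x ∷ xs) = ([ x ] , xs) ∷ map (map₁ (x ∷_)) (prefixSplits xs)

prefixSplits-suffix< : {X : Set} (u : List X) → All (λ (a , b) → length b < length u) (prefixSplits u)
prefixSplits-suffix< []       = []
prefixSplits-suffix< (x ∷ xs) = ≤-refl ∷ map⁺ (All.map m≤n⇒m≤1+n (prefixSplits-suffix< xs))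

zipWith-∷ʳ : {a b d : Level} {X : Set a} {Y : Set b} {Z : Set d}
             (f : X → Y → Z) (xs : List X) (ys : List Y) (x : X) (y : Y) →
             length xs ≡ length ys → zipWith f (xs ++ [ x ]) (ys ++ [ y ]) ≡ zipWith f xs ys ++ [ f x y ]
zipWith-∷ʳ f []       []       x y _  = P.refl
zipWith-∷ʳ f (a ∷ xs) (b ∷ ys) x y eq = P.cong (f a b ∷_) (zipWith-∷ʳ f xs ys x y (suc-injective eq))

extendPartition : {X : Set} → X → List (List X) → List (List (List X))
extendPartition x []       = ([ x ] ∷ []) ∷ []
extendPartition x (b ∷ bs) = ([ x ] ∷ b ∷ bs) ∷ ((x ∷ b) ∷ bs) ∷ []

intervalPartitions-∷ : {X : Set} (x : X) (xs : List X) →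
                       intervalPartitions (x ∷ xs) ≡ concatMap (extendPartition x) (intervalPartitions xs)
intervalPartitions-∷ x xs = concatMap-cong (λ { [] → P.refl ; (b ∷ bs) → P.refl }) (intervalPartitions xs)

intervalPartitions-length : {X : Set} (xs : List X) → All (λ p → length p ≤ length xs) (intervalPartitions xs)
intervalPartitions-length []       = z≤n ∷ []
intervalPartitions-length (x ∷ xs) rewrite intervalPartitions-∷ x xs =
  concat⁺ (map⁺ (All.map extend (intervalPartitions-length xs)))
  where
  extend : ∀ {p} → length p ≤ length xs → All (λ q → length q ≤ suc (length xs)) (extendPartition x p)
  extend {[]}     _  = s≤s z≤n ∷ []
  extend {b ∷ bs} le = s≤s le ∷ m≤n⇒m≤1+n le ∷ []

wordsOf-length : (N k : ℕ) → All (λ w → length w ≡ k) (wordsOf N k)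
wordsOf-length N zero    = P.refl ∷ []
wordsOf-length N (suc k) =
  concat⁺ (map⁺ (All.universal (λ i → map⁺ (All.map (P.cong suc) (wordsOf-length N k))) (allFin N)))

coarserPartitions : {X : Set} → List X → List (List (List X))
coarserPartitions u = filterᵇ (λ p → length p <ᵇ length u) (intervalPartitions u)

coarserPartitions-length : {X : Set} (u : List X) → All (λ p → length p < length u) (coarserPartitions u)
coarserPartitions-length u =
  All.map (λ {p} → <ᵇ⇒< (length p) (length u)) (all-filter (λ p → T? (length p <ᵇ length u)) (intervalPartitions u))

module PartitionSums {c ℓ : Level} (R : Ring c ℓ) where
  open Ring R
  open Sums R
  open import Relation.Binary.Reasoning.Setoid setoid

  private
    IP : {X : Set} → List X → List (List (List X))
    IP = intervalPartitions

  joinFirst : {X : Set} → X → (List (List X) → Carrier) → List (List X) → Carrier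
  joinFirst x θ []       = 0#
  joinFirst x θ (b ∷ bs) = θ ((x ∷ b) ∷ bs)

  ∑IP-∷ : {X : Set} (x : X) (xs : List X) (θ : List (List X) → Carrier) →
          ∑ (IP (x ∷ xs)) θ ≈ ∑[ p ∈ IP xs ] θ ([ x ] ∷ p) + ∑ (IP xs) (joinFirst x θ)
  ∑IP-∷ x xs θ = begin
    ∑ (IP (x ∷ xs)) θ                                   ≡⟨ P.cong (λ ps → ∑ ps θ) (intervalPartitions-∷ x xs) ⟩
    ∑ (concatMap (extendPartition x) (IP xs)) θ          ≈⟨ ∑-concatMap (extendPartition x) (IP xs) θ ⟩
    ∑[ p ∈ IP xs ] ∑ (extendPartition x p) θ            ≈⟨ ∑-cong (IP xs) extend ⟩
    ∑[ p ∈ IP xs ] (θ ([ x ] ∷ p) + joinFirst x θ p)    ≈⟨ ∑-+ (IP xs) _ _ ⟩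
    ∑[ p ∈ IP xs ] θ ([ x ] ∷ p) + ∑ (IP xs) (joinFirst x θ) ∎
    where
    extend : ∀ p → ∑ (extendPartition x p) θ ≈ θ ([ x ] ∷ p) + joinFirst x θ p
    extend []       = refl
    extend (b ∷ bs) = +-congˡ (+-identityʳ _)

  ∑IP-firstBlock : {X : Set} (x : X) (xs : List X) (θ : List (List X) → Carrier) →
                   ∑ (IP (x ∷ xs)) θ ≈ ∑[ (a , b) ∈ prefixSplits (x ∷ xs) ] ∑[ p ∈ IP b ] θ (a ∷ p)
  ∑IP-firstBlock x []       θ = +-congʳ (sym (+-identityʳ _))
  ∑IP-firstBlock x (y ∷ ys) θ = begin
    ∑ (IP (x ∷ y ∷ ys)) θ
      ≈⟨ ∑IP-∷ x (y ∷ ys) θ ⟩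
    ∑[ p ∈ IP (y ∷ ys) ] θ ([ x ] ∷ p) + ∑ (IP (y ∷ ys)) (joinFirst x θ)
      ≈⟨ +-congˡ (∑IP-firstBlock y ys (joinFirst x θ)) ⟩
    ∑[ p ∈ IP (y ∷ ys) ] θ ([ x ] ∷ p) + ∑[ (a , b) ∈ prefixSplits (y ∷ ys) ] ∑[ p ∈ IP b ] θ ((x ∷ a) ∷ p)
      ≈⟨ +-congˡ (∑-map (map₁ (x ∷_)) (prefixSplits (y ∷ ys)) _) ⟨
    ∑[ (a , b) ∈ prefixSplits (x ∷ y ∷ ys) ] ∑[ p ∈ IP b ] θ (a ∷ p) ∎

  ∑IP-finestOnly : {X : Set} (u : List X) (θ : List (List X) → Carrier) →
                   ∑[ p ∈ IP u ] (if length p <ᵇ length u then 0# else θ p) ≈ θ (map [_] u)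
  ∑IP-finestOnly []       θ = +-identityʳ _
  ∑IP-finestOnly (x ∷ xs) θ =
    trans (∑IP-∷ x xs _)
          (trans (+-cong (∑IP-finestOnly xs (λ p → θ ([ x ] ∷ p)))
                         (∑-cong-All (All.map (λ {p} → coarse p) (intervalPartitions-length xs))))
                 (trans (+-congˡ (∑-zero (IP xs) (λ _ → refl))) (+-identityʳ _)))
    where
    coarse : ∀ p → length p ≤ length xs →
             joinFirst x (λ q → if length q <ᵇ suc (length xs) then 0# else θ q) p ≈ 0#
    coarse []       _  = refl
    coarse (b ∷ bs) le with length bs <ᵇ length xs | <⇒<ᵇ le
    ... | true  | _  = refl
    ... | false | ()

  ∑IP-finest+coarser : {X : Set} (u : List X) (θ : List (List X) → Carrier) →
                       ∑ (IP u) θ ≈ θ (map [_] u) + ∑ (coarserPartitions u) θ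
  ∑IP-finest+coarser u θ =
    trans (∑-filterᵇ (λ p → length p <ᵇ length u) (IP u) θ) (trans (+-comm _ _) (+-congʳ (∑IP-finestOnly u θ)))

  ∑prefixSplits-∷ : {X : Set} (x : X) (xs : List X) (Θ : List X × List X → Carrier) →
    ∑ (prefixSplits (x ∷ xs)) Θ ≈ ∑[ (a , b) ∈ ([] , xs) ∷ prefixSplits xs ] Θ (x ∷ a , b)
  ∑prefixSplits-∷ x xs Θ = ∑-map (map₁ (x ∷_)) (([] , xs) ∷ prefixSplits xs) Θ

  ∑prefixSplits-first : {X : Set} (x : X) (xs : List X) (Θ : List X × List X → Carrier) →
    (∀ y a b → Θ (x ∷ y ∷ a , b) ≈ 0#) → ∑ (prefixSplits (x ∷ xs)) Θ ≈ Θ ([ x ] , xs)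
  ∑prefixSplits-first x []       Θ Θ≈0 = +-identityʳ _
  ∑prefixSplits-first x (y ∷ ys) Θ Θ≈0 = trans (+-congˡ longer≈0) (+-identityʳ _)
    where
    longer≈0 : ∑ (map (map₁ (x ∷_)) (prefixSplits (y ∷ ys))) Θ ≈ 0#
    longer≈0 = trans (∑-map (map₁ (x ∷_)) (prefixSplits (y ∷ ys)) Θ)
                     (trans (∑prefixSplits-∷ y ys _) (∑-zero (([] , ys) ∷ prefixSplits ys) (λ (a , b) → Θ≈0 y a b)))

  ∑prefixSplits-whole : {X : Set} (x : X) (xs : List X) (Θ : List X × List X → Carrier) →
    (∀ a y b → Θ (a , y ∷ b) ≈ 0#) → ∑ (prefixSplits (x ∷ xs)) Θ ≈ Θ (x ∷ xs , [])
  ∑prefixSplits-whole x []       Θ Θ≈0 = +-identityʳ _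
  ∑prefixSplits-whole x (y ∷ ys) Θ Θ≈0 =
    trans (+-cong (Θ≈0 [ x ] y ys) (trans (∑-map (map₁ (x ∷_)) (prefixSplits (y ∷ ys)) Θ)
                                          (∑prefixSplits-whole y ys _ (λ a → Θ≈0 (x ∷ a)))))
          (+-identityˡ _)

  ∑prefixSplits-assoc : {X : Set} (u : List X) (Γ : List X → List X → List X → Carrier) →
    ∑[ (c , d) ∈ prefixSplits u ] ∑[ (e , g) ∈ prefixSplits c ] Γ e g d ≈
    ∑[ (e , f) ∈ prefixSplits u ] (Γ e [] f + ∑[ (g , d) ∈ prefixSplits f ] Γ e g d)
  ∑prefixSplits-assoc []       Γ = refl
  ∑prefixSplits-assoc (x ∷ xs) Γ = begin
    (Γ [ x ] [] xs + 0#) + ∑ (map (map₁ (x ∷_)) S) inner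
      ≈⟨ +-cong (+-identityʳ _) (∑-map (map₁ (x ∷_)) S inner) ⟩
    Γ [ x ] [] xs + ∑[ (c , d) ∈ S ] (Γ [ x ] c d + ∑ (map (map₁ (x ∷_)) (prefixSplits c)) (λ (e , g) → Γ e g d))
      ≈⟨ +-congˡ (∑-cong S (λ (c , d) → +-congˡ (∑-map (map₁ (x ∷_)) (prefixSplits c) _))) ⟩
    Γ [ x ] [] xs + ∑[ (c , d) ∈ S ] (Γ [ x ] c d + ∑[ (e , g) ∈ prefixSplits c ] Γ (x ∷ e) g d)
      ≈⟨ +-congˡ (∑-+ S _ _) ⟩
    Γ [ x ] [] xs + (∑[ (c , d) ∈ S ] Γ [ x ] c d + ∑[ (c , d) ∈ S ] ∑[ (e , g) ∈ prefixSplits c ] Γ (x ∷ e) g d)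
      ≈⟨ +-assoc _ _ _ ⟨
    (Γ [ x ] [] xs + ∑[ (c , d) ∈ S ] Γ [ x ] c d) + ∑[ (c , d) ∈ S ] ∑[ (e , g) ∈ prefixSplits c ] Γ (x ∷ e) g d
      ≈⟨ +-congˡ (trans (∑prefixSplits-assoc xs (λ e → Γ (x ∷ e))) (sym (∑-map (map₁ (x ∷_)) S _))) ⟩
    (Γ [ x ] [] xs + ∑[ (c , d) ∈ S ] Γ [ x ] c d) + ∑ (map (map₁ (x ∷_)) S) outer ∎
    where
    S : List (List _ × List _)
    S = prefixSplits xs
    inner : List _ × List _ → Carrier
    inner (c , d) = ∑[ (e , g) ∈ prefixSplits c ] Γ e g d
    outer : List _ × List _ → Carrier
    outer (e , f) = Γ e [] f + ∑[ (g , d) ∈ prefixSplits f ] Γ e g d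

module ColouredSums {c ℓ : Level} (R : Ring c ℓ) (N : ℕ) where
  open Ring R
  open RingProperties R using (+-cancelʳ)
  open Sums R
  open PartitionSums R
  open Series R using (Π'; δ; coeff; idSer; Ser; _∘ˢ_)
  open import Relation.Binary.Reasoning.Setoid setoid

  private
    IP : Word N → List (List (Word N))
    IP = intervalPartitions

  ∑coloured : (Word N → List (Word N) → Carrier) → Word N → Carrier
  ∑coloured Φ u = ∑[ p ∈ IP u ] ∑[ w ∈ wordsOf N (length p) ] Φ w p

  ∏blocks : (Fin N → Word N → Carrier) → Word N → List (Word N) → Carrier
  ∏blocks X w p = Π' (zipWith X w p)

  -- The coefficient of z_u in g(X(z)), with the coefficient of g written to the right.
  precompose : (Fin N → Word N → Carrier) → (Word N → Carrier) → Word N → Carrier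
  precompose X g = ∑coloured (λ w p → ∏blocks X w p * g w)

  ∘ˢ-as-∑coloured : (K L : Ser N) (i : Fin N) (u : Word N) →
                    (K ∘ˢ L) i u ≈ ∑coloured (λ w p → coeff K i w * ∏blocks (coeff L) w p) u
  ∘ˢ-as-∑coloured K L i u = Σ'-concatMap-map _ _ (IP u)

  coeff-idSer-long : (i : Fin N) (u : Word N) → 2 ≤ length u → coeff idSer i u ≈ 0#
  coeff-idSer-long i (a ∷ b ∷ r) _          = refl
  coeff-idSer-long i (a ∷ [])    (s≤s ())

  ∑coloured-cong : {Φ Ψ : Word N → List (Word N) → Carrier} → (∀ w p → Φ w p ≈ Ψ w p) →
                   ∀ u → ∑coloured Φ u ≈ ∑coloured Ψ u
  ∑coloured-cong Φ≈Ψ u = ∑-cong (IP u) (λ p → ∑-cong (wordsOf N (length p)) (λ w → Φ≈Ψ w p))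

  ∑coloured-cong-length : {Φ Ψ : Word N → List (Word N) → Carrier} →
                          (∀ w p → length w ≡ length p → Φ w p ≈ Ψ w p) →
                          ∀ u → ∑coloured Φ u ≈ ∑coloured Ψ u
  ∑coloured-cong-length Φ≈Ψ u =
    ∑-cong (IP u) (λ p → ∑-cong-All (All.map (λ {w} → Φ≈Ψ w p) (wordsOf-length N (length p))))

  ∑coloured-zero : {Φ : Word N → List (Word N) → Carrier} → (∀ w p → Φ w p ≈ 0#) →
                   ∀ u → ∑coloured Φ u ≈ 0#
  ∑coloured-zero Φ≈0 u = ∑-zero (IP u) (λ p → ∑-zero (wordsOf N (length p)) (λ w → Φ≈0 w p))

  ∑coloured-+ : (Φ Ψ : Word N → List (Word N) → Carrier) (u : Word N) →
                ∑coloured (λ w p → Φ w p + Ψ w p) u ≈ ∑coloured Φ u + ∑coloured Ψ u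
  ∑coloured-+ Φ Ψ u = trans (∑-cong (IP u) (λ p → ∑-+ (wordsOf N (length p)) _ _)) (∑-+ (IP u) _ _)

  ∑coloured-∑ : {X : Set} (xs : List X) (Φ : X → Word N → List (Word N) → Carrier) (u : Word N) →
                ∑coloured (λ w p → ∑[ x ∈ xs ] Φ x w p) u ≈ ∑[ x ∈ xs ] ∑coloured (Φ x) u
  ∑coloured-∑ xs Φ u = trans (∑-cong (IP u) (λ p → ∑-comm (wordsOf N (length p)) xs _)) (∑-comm (IP u) xs _)

  *-distribˡ-∑coloured : (a : Carrier) (Φ : Word N → List (Word N) → Carrier) (u : Word N) →
                         a * ∑coloured Φ u ≈ ∑coloured (λ w p → a * Φ w p) u
  *-distribˡ-∑coloured a Φ u =
    trans (*-distribˡ-∑ a (IP u) _) (∑-cong (IP u) (λ p → *-distribˡ-∑ a (wordsOf N (length p)) _))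

  *-distribʳ-∑coloured : (a : Carrier) (Φ : Word N → List (Word N) → Carrier) (u : Word N) →
                         ∑coloured Φ u * a ≈ ∑coloured (λ w p → Φ w p * a) u
  *-distribʳ-∑coloured a Φ u =
    trans (*-distribʳ-∑ a (IP u) _) (∑-cong (IP u) (λ p → *-distribʳ-∑ a (wordsOf N (length p)) _))

  ∑wordsOf-suc : (q : ℕ) (f : Word N → Carrier) →
                 ∑ (wordsOf N (suc q)) f ≈ ∑[ j ∈ allFin N ] ∑[ w ∈ wordsOf N q ] f (j ∷ w)
  ∑wordsOf-suc q f =
    trans (∑-concatMap _ (allFin N) f) (∑-cong (allFin N) (λ j → ∑-map (j ∷_) (wordsOf N q) f))

  ∑coloured-firstBlock : (Φ : Word N → List (Word N) → Carrier) (x : Fin N) (xs : Word N) →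
    ∑coloured Φ (x ∷ xs) ≈
    ∑[ (a , b) ∈ prefixSplits (x ∷ xs) ] ∑[ j ∈ allFin N ] ∑coloured (λ w p → Φ (j ∷ w) (a ∷ p)) b
  ∑coloured-firstBlock Φ x xs = trans (∑IP-firstBlock x xs _) (∑-cong (prefixSplits (x ∷ xs)) λ (a , b) →
    trans (∑-cong (IP b) (λ p → ∑wordsOf-suc (length p) (λ w → Φ w (a ∷ p)))) (∑-comm (IP b) (allFin N) _))

  precompose-cong : (X : Fin N → Word N → Carrier) {g g′ : Word N → Carrier} →
                    (∀ w → g w ≈ g′ w) → ∀ u → precompose X g u ≈ precompose X g′ u
  precompose-cong X g≈g′ = ∑coloured-cong (λ w p → *-congˡ (g≈g′ w))

  precompose-[] : (X : Fin N → Word N → Carrier) (g : Word N → Carrier) → precompose X g [] ≈ g []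
  precompose-[] X g = trans (+-identityʳ _) (trans (+-identityʳ _) (*-identityˡ _))

  precompose-firstBlock : (X : Fin N → Word N → Carrier) (g : Word N → Carrier) (x : Fin N) (xs : Word N) →
    precompose X g (x ∷ xs) ≈
    ∑[ (e , f) ∈ prefixSplits (x ∷ xs) ] ∑[ k ∈ allFin N ] (X k e * precompose X (λ w → g (k ∷ w)) f)
  precompose-firstBlock X g x xs = trans (∑coloured-firstBlock _ x xs) (∑-cong (prefixSplits (x ∷ xs)) λ (e , f) →
    ∑-cong (allFin N) λ k → trans (∑coloured-cong (λ w p → *-assoc _ _ _) f) (sym (*-distribˡ-∑coloured _ _ f)))

  ∏blocks-singletons : (F : Ser N) (g : Word N → Carrier) (u : Word N) →
    ∑[ w ∈ wordsOf N (length (map [_] u)) ] (∏blocks (coeff F) w (map [_] u) * g w) ≈ g u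
  ∏blocks-singletons F g []       = trans (+-identityʳ _) (*-identityˡ _)
  ∏blocks-singletons F g (x ∷ xs) = begin
    ∑[ w ∈ wordsOf N (suc (length (map [_] xs))) ] (∏blocks (coeff F) w (map [_] (x ∷ xs)) * g w)
      ≈⟨ ∑wordsOf-suc (length (map [_] xs)) _ ⟩
    ∑[ j ∈ allFin N ] ∑[ w ∈ wordsOf N (length (map [_] xs)) ] ((δ j x * ∏blocks (coeff F) w (map [_] xs)) * g (j ∷ w))
      ≈⟨ ∑-cong (allFin N) (λ j → trans (∑-cong (wordsOf N (length (map [_] xs)))
                                                      (λ w → *-assoc (δ j x) (∏blocks (coeff F) w (map [_] xs)) (g (j ∷ w))))
                                              (sym (*-distribˡ-∑ (δ j x) (wordsOf N (length (map [_] xs)))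
                                                   (λ w → ∏blocks (coeff F) w (map [_] xs) * g (j ∷ w))))) ⟩
    ∑[ j ∈ allFin N ] (δ j x * ∑[ w ∈ wordsOf N (length (map [_] xs)) ] (∏blocks (coeff F) w (map [_] xs) * g (j ∷ w)))
      ≈⟨ ∑-cong (allFin N) (λ j → *-congˡ (∏blocks-singletons F (λ w → g (j ∷ w)) xs)) ⟩
    ∑[ j ∈ allFin N ] (δ j x * g (j ∷ xs))
      ≈⟨ ∑-δˡ N x (λ j → g (j ∷ xs)) ⟩
    g (x ∷ xs) ∎

  coarsePart : (Fin N → Word N → Carrier) → (Word N → Carrier) → Word N → Carrier
  coarsePart X g u = ∑[ p ∈ coarserPartitions u ] ∑[ w ∈ wordsOf N (length p) ] (∏blocks X w p * g w)

  coarsePart-cong : (X : Fin N → Word N → Carrier) {g g′ : Word N → Carrier} (u : Word N) →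
                    (∀ w → length w < length u → g w ≈ g′ w) → coarsePart X g u ≈ coarsePart X g′ u
  coarsePart-cong X u g≈g′ = ∑-cong-All (All.map (λ {p} p<u → ∑-cong-All (All.map
    (λ {w} w≡p → *-congˡ (g≈g′ w (P.subst (_< length u) (P.sym w≡p) p<u))) (wordsOf-length N (length p))))
    (coarserPartitions-length u))

  precompose-leading : (F : Ser N) (g : Word N → Carrier) (u : Word N) →
                       precompose (coeff F) g u ≈ g u + coarsePart (coeff F) g u
  precompose-leading F g u = trans (∑IP-finest+coarser u _) (+-congʳ (∏blocks-singletons F g u))

  precompose-+ : (X : Fin N → Word N → Carrier) (g g′ : Word N → Carrier) (u : Word N) →
                 precompose X (λ w → g w + g′ w) u ≈ precompose X g u + precompose X g′ u
  precompose-+ X g g′ u = trans (∑coloured-cong (λ w p → distribˡ _ _ _) u) (∑coloured-+ _ _ u)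

  precompose-∑ : {J : Set} (X : Fin N → Word N → Carrier) (js : List J) (g : J → Word N → Carrier) (u : Word N) →
                 precompose X (λ w → ∑[ j ∈ js ] g j w) u ≈ ∑[ j ∈ js ] precompose X (g j) u
  precompose-∑ X js g u = trans (∑coloured-cong (λ w p → *-distribˡ-∑ _ js _) u) (∑coloured-∑ js _ u)

  precompose-*ʳ : (X : Fin N → Word N → Carrier) (g : Word N → Carrier) (a : Carrier) (u : Word N) →
                  precompose X (λ w → g w * a) u ≈ precompose X g u * a
  precompose-*ʳ X g a u = trans (∑coloured-cong (λ w p → sym (*-assoc _ _ _)) u) (sym (*-distribʳ-∑coloured a _ u))

  precompose-∷-cong : (X : Fin N → Word N → Carrier) {g g′ : Word N → Carrier} →
                      (∀ y w → g (y ∷ w) ≈ g′ (y ∷ w)) →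
                      ∀ x xs → precompose X g (x ∷ xs) ≈ precompose X g′ (x ∷ xs)
  precompose-∷-cong X {g} {g′} g≈g′ x xs =
    trans (precompose-firstBlock X g x xs)
          (trans (∑-cong (prefixSplits (x ∷ xs)) λ (e , f) → ∑-cong (allFin N) λ k →
                    *-congˡ (precompose-cong X (g≈g′ k) f))
                 (sym (precompose-firstBlock X g′ x xs)))

  precompose-idSer : (G : Ser N) (i : Fin N) (u : Word N) → precompose (coeff G) (coeff idSer i) u ≈ coeff G i u
  precompose-idSer G i []       = precompose-[] (coeff G) (coeff idSer i)
  precompose-idSer G i (x ∷ xs) = begin
    precompose (coeff G) (coeff idSer i) (x ∷ xs)
      ≈⟨ precompose-firstBlock (coeff G) (coeff idSer i) x xs ⟩
    ∑[ (e , f) ∈ prefixSplits (x ∷ xs) ] ∑[ k ∈ allFin N ] (coeff G k e * precompose (coeff G) (after k) f)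
      ≈⟨ ∑prefixSplits-whole x xs _ (λ a y b →
           ∑-zero (allFin N) λ k → trans (*-congˡ (after≈0 k y b)) (zeroʳ _)) ⟩
    ∑[ k ∈ allFin N ] (coeff G k (x ∷ xs) * precompose (coeff G) (after k) [])
      ≈⟨ ∑-cong (allFin N) (λ k → *-congˡ (precompose-[] (coeff G) (after k))) ⟩
    ∑[ k ∈ allFin N ] (coeff G k (x ∷ xs) * δ i k)
      ≈⟨ ∑-δʳ N i (λ k → coeff G k (x ∷ xs)) ⟩
    coeff G i (x ∷ xs) ∎
    where
    after : Fin N → Word N → Carrier
    after k w = coeff idSer i (k ∷ w)
    after≈0 : ∀ k y b → precompose (coeff G) (after k) (y ∷ b) ≈ 0#
    after≈0 k y b = trans (precompose-∷-cong (coeff G) {g′ = λ _ → 0#} (λ _ _ → refl) y b)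
                          (∑coloured-zero (λ w p → zeroʳ _) (y ∷ b))

  splitSum : (Word N → Word N → Carrier) → Word N → Carrier
  splitSum G v = ∑[ (a , b) ∈ prefixSplits v ] G a b

  splitTerm : (Fin N → Word N → Carrier) → (Word N → Word N → Carrier) → Word N → Word N → Word N → Carrier
  splitTerm X G e g d = ∑[ k ∈ allFin N ] (X k e * precompose X (λ w → precompose X (G (k ∷ w)) d) g)

  precompose-splitSum-∷ : (X : Fin N → Word N → Carrier) (G : Word N → Word N → Carrier) (k : Fin N) (f : Word N) →
    precompose X (λ w → splitSum G (k ∷ w)) f ≈ precompose X (G [ k ]) f + precompose X (splitSum (λ a → G (k ∷ a))) f
  precompose-splitSum-∷ X G k f =
    trans (precompose-cong X (λ w → +-congˡ (∑-map (map₁ (k ∷_)) (prefixSplits w) _)) f) (precompose-+ X _ _ f)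

  precompose-splitSum-firstBlock : (X : Fin N → Word N → Carrier) (G : Word N → Word N → Carrier) (e f : Word N) →
    (∀ k → precompose X (splitSum (λ a → G (k ∷ a))) f ≈
           ∑[ (g , d) ∈ prefixSplits f ] precompose X (λ a → precompose X (G (k ∷ a)) d) g) →
    ∑[ k ∈ allFin N ] (X k e * precompose X (λ w → splitSum G (k ∷ w)) f) ≈
    splitTerm X G e [] f + ∑[ (g , d) ∈ prefixSplits f ] splitTerm X G e g d
  precompose-splitSum-firstBlock X G e f splitsAtf = begin
    ∑[ k ∈ allFin N ] (X k e * precompose X (λ w → splitSum G (k ∷ w)) f)
      ≈⟨ ∑-cong (allFin N) (λ k → trans (*-congˡ (trans (precompose-splitSum-∷ X G k f) (+-congˡ (splitsAtf k))))
                                        (trans (distribˡ _ _ _) (+-congˡ (*-distribˡ-∑ _ (prefixSplits f) _)))) ⟩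
    ∑[ k ∈ allFin N ] (X k e * precompose X (G [ k ]) f + ∑[ (g , d) ∈ prefixSplits f ] (X k e * later k g d))
      ≈⟨ ∑-+ (allFin N) _ _ ⟩
    ∑[ k ∈ allFin N ] (X k e * precompose X (G [ k ]) f) +
      ∑[ k ∈ allFin N ] ∑[ (g , d) ∈ prefixSplits f ] (X k e * later k g d)
      ≈⟨ +-cong (∑-cong (allFin N) (λ k → *-congˡ (sym (precompose-[] X (λ w → precompose X (G (k ∷ w)) f)))))
                (∑-comm (allFin N) (prefixSplits f) _) ⟩
    splitTerm X G e [] f + ∑[ (g , d) ∈ prefixSplits f ] splitTerm X G e g d ∎
    where
    later : Fin N → Word N → Word N → Carrier
    later k g d = precompose X (λ a → precompose X (G (k ∷ a)) d) g

  -- Cutting the colour word of a coloured partition of u cuts u into two coloured pieces.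
  precompose-splitSum : (X : Fin N → Word N → Carrier) (n : ℕ) (u : Word N) → length u ≤ n →
    (G : Word N → Word N → Carrier) →
    precompose X (splitSum G) u ≈ ∑[ (c , d) ∈ prefixSplits u ] precompose X (λ a → precompose X (G a) d) c
  precompose-splitSum X n       []       _          G = precompose-[] X (λ _ → 0#)
  precompose-splitSum X (suc n) (x ∷ xs) (s≤s xs≤n) G = begin
    precompose X (splitSum G) (x ∷ xs)
      ≈⟨ precompose-firstBlock X (splitSum G) x xs ⟩
    ∑[ (e , f) ∈ prefixSplits (x ∷ xs) ] ∑[ k ∈ allFin N ] (X k e * precompose X (λ w → splitSum G (k ∷ w)) f)
      ≈⟨ ∑-cong-All (All.map (λ {ef} f<u → splitFirst ef (≤-trans (≤-pred f<u) xs≤n))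
                             (prefixSplits-suffix< (x ∷ xs))) ⟩
    ∑[ (e , f) ∈ prefixSplits (x ∷ xs) ] (splitTerm X G e [] f + ∑[ (g , d) ∈ prefixSplits f ] splitTerm X G e g d)
      ≈⟨ ∑prefixSplits-assoc (x ∷ xs) (splitTerm X G) ⟨
    ∑[ (c , d) ∈ prefixSplits (x ∷ xs) ] ∑[ (e , g) ∈ prefixSplits c ] splitTerm X G e g d
      ≈⟨ ∑prefixSplits-∷ x xs _ ⟩
    ∑[ (c , d) ∈ ([] , xs) ∷ prefixSplits xs ] ∑[ (e , g) ∈ prefixSplits (x ∷ c) ] splitTerm X G e g d
      ≈⟨ ∑-cong (([] , xs) ∷ prefixSplits xs)
                (λ (c , d) → sym (precompose-firstBlock X (λ a → precompose X (G a) d) x c)) ⟩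
    ∑[ (c , d) ∈ ([] , xs) ∷ prefixSplits xs ] precompose X (λ a → precompose X (G a) d) (x ∷ c)
      ≈⟨ ∑prefixSplits-∷ x xs _ ⟨
    ∑[ (c , d) ∈ prefixSplits (x ∷ xs) ] precompose X (λ a → precompose X (G a) d) c ∎
    where
    splitFirst : ((e , f) : Word N × Word N) → length f ≤ n →
      ∑[ k ∈ allFin N ] (X k e * precompose X (λ w → splitSum G (k ∷ w)) f) ≈
      splitTerm X G e [] f + ∑[ (g , d) ∈ prefixSplits f ] splitTerm X G e g d
    splitFirst (e , f) f≤n =
      precompose-splitSum-firstBlock X G e f (λ k → precompose-splitSum X n f f≤n (λ a → G (k ∷ a)))

  precompose-cancel : (F : Ser N) {g g′ : Word N → Carrier} (u : Word N) →
    (∀ w → length w < length u → g w ≈ g′ w) →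
    precompose (coeff F) g u ≈ precompose (coeff F) g′ u → g u ≈ g′ u
  precompose-cancel F {g} {g′} u shorter pg≈pg′ = +-cancelʳ _ _ _ (begin
    g u + coarsePart (coeff F) g u   ≈⟨ precompose-leading F g u ⟨
    precompose (coeff F) g u         ≈⟨ pg≈pg′ ⟩
    precompose (coeff F) g′ u        ≈⟨ precompose-leading F g′ u ⟩
    g′ u + coarsePart (coeff F) g′ u ≈⟨ +-congˡ (coarsePart-cong (coeff F) u shorter) ⟨
    g′ u + coarsePart (coeff F) g u  ∎)

  precompose-injective : (F : Ser N) {g g′ : Word N → Carrier} →
    (∀ u → precompose (coeff F) g u ≈ precompose (coeff F) g′ u) → ∀ u → g u ≈ g′ u
  precompose-injective F {g} {g′} pg≈pg′ u = bounded (length u) u ≤-refl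
    where
    bounded : ∀ n u → length u ≤ n → g u ≈ g′ u
    bounded zero    []  _   = precompose-cancel F {g} {g′} [] (λ w ()) (pg≈pg′ [])
    bounded (suc n) u u≤n = precompose-cancel F u (λ w w<u → bounded n w (≤-pred (≤-trans w<u u≤n))) (pg≈pg′ u)

reversePartition : {X : Set} → List (List X) → List (List X)
reversePartition p = reverse (map reverse p)

reversePartition-∷ : {X : Set} (b : List X) (q : List (List X)) →
                     reversePartition (b ∷ q) ≡ reversePartition q ++ [ reverse b ]
reversePartition-∷ b q = unfold-reverse (reverse b) (map reverse q)

reversePartition-length : {X : Set} (p : List (List X)) → length (reversePartition p) ≡ length p
reversePartition-length p = P.trans (length-reverse (map reverse p)) (length-map reverse p)

module Reversal {c ℓ : Level} (R : Ring c ℓ) where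
  open Ring R
  open CommutativeSemigroupProperties +-commutativeSemigroup using (interchange)
  open Sums R
  open PartitionSums R
  open import Relation.Binary.Reasoning.Setoid setoid

  private
    IP : {X : Set} → List X → List (List (List X))
    IP = intervalPartitions

  joinLast : {X : Set} → X → (List (List X) → Carrier) → List (List X) → Carrier
  joinLast x θ []          = 0#
  joinLast x θ (b ∷ [])    = θ ((b ++ [ x ]) ∷ [])
  joinLast x θ (b ∷ c ∷ r) = joinLast x (λ q → θ (b ∷ q)) (c ∷ r)

  joinLast-+ : {X : Set} (θ θ′ : List (List X) → Carrier) (x : X) (p : List (List X)) →
               joinLast x (λ q → θ q + θ′ q) p ≈ joinLast x θ p + joinLast x θ′ p
  joinLast-+ θ θ′ x []          = sym (+-identityʳ _)
  joinLast-+ θ θ′ x (b ∷ [])    = refl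
  joinLast-+ θ θ′ x (b ∷ c ∷ r) = joinLast-+ (λ q → θ (b ∷ q)) (λ q → θ′ (b ∷ q)) x (c ∷ r)

  joinLast-joinFirst : {X : Set} (θ : List (List X) → Carrier) (x y : X) (b : List X) (bs : List (List X)) →
                       joinLast x (joinFirst y θ) (b ∷ bs) ≈ joinLast x θ ((y ∷ b) ∷ bs)
  joinLast-joinFirst θ x y b []      = refl
  joinLast-joinFirst θ x y b (c ∷ r) = refl

  joinLast-∷ʳ : {X : Set} (θ : List (List X) → Carrier) (x : X) (q : List (List X)) (b : List X) →
                joinLast x θ (q ++ [ b ]) ≈ θ (q ++ [ b ++ [ x ] ])
  joinLast-∷ʳ θ x []          b = refl
  joinLast-∷ʳ θ x (a ∷ [])    b = refl
  joinLast-∷ʳ θ x (a ∷ c ∷ q) b = joinLast-∷ʳ (λ q′ → θ (a ∷ q′)) x (c ∷ q) b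

  ∑IP-∷ʳ : {X : Set} (ys : List X) (x : X) (θ : List (List X) → Carrier) →
           ∑ (IP (ys ++ [ x ])) θ ≈ ∑[ p ∈ IP ys ] (θ (p ++ [ [ x ] ]) + joinLast x θ p)
  ∑IP-∷ʳ []       x θ = sym (+-identityʳ _)
  ∑IP-∷ʳ (y ∷ ys) x θ = begin
    ∑ (IP (y ∷ ys ++ [ x ])) θ
      ≈⟨ trans (∑IP-∷ y (ys ++ [ x ]) θ) (sym (∑-+ (IP (ys ++ [ x ])) _ _)) ⟩
    ∑ (IP (ys ++ [ x ])) θy
      ≈⟨ ∑IP-∷ʳ ys x θy ⟩
    ∑[ p ∈ IP ys ] (θy (p ++ [ [ x ] ]) + joinLast x θy p)
      ≈⟨ ∑-cong (IP ys) regroup ⟩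
    ∑[ p ∈ IP ys ] ((θ ([ y ] ∷ p ++ [ [ x ] ]) + joinLast x θ ([ y ] ∷ p)) + joinFirst y θx p)
      ≈⟨ trans (∑-+ (IP ys) _ _) (sym (∑IP-∷ y ys θx)) ⟩
    ∑ (IP (y ∷ ys)) θx ∎
    where
    θy : List (List _) → Carrier
    θy q = θ ([ y ] ∷ q) + joinFirst y θ q
    θx : List (List _) → Carrier
    θx q = θ (q ++ [ [ x ] ]) + joinLast x θ q
    regroup : ∀ p → θy (p ++ [ [ x ] ]) + joinLast x θy p ≈
                    (θ ([ y ] ∷ p ++ [ [ x ] ]) + joinLast x θ ([ y ] ∷ p)) + joinFirst y θx p
    regroup []       = refl
    regroup (b ∷ bs) = trans (+-congˡ (trans (joinLast-+ _ _ x (b ∷ bs)) (+-congˡ (joinLast-joinFirst θ x y b bs))))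
                             (interchange _ _ _ _)

  ∑IP-reverse : {X : Set} (u : List X) (θ : List (List X) → Carrier) →
                ∑ (IP (reverse u)) θ ≈ ∑[ p ∈ IP u ] θ (reversePartition p)
  ∑IP-reverse []       θ = refl
  ∑IP-reverse (x ∷ xs) θ = begin
    ∑ (IP (reverse (x ∷ xs))) θ
      ≡⟨ P.cong (λ v → ∑ (IP v) θ) (unfold-reverse x xs) ⟩
    ∑ (IP (reverse xs ++ [ x ])) θ
      ≈⟨ ∑IP-∷ʳ (reverse xs) x θ ⟩
    ∑ (IP (reverse xs)) θx
      ≈⟨ ∑IP-reverse xs θx ⟩
    ∑[ q ∈ IP xs ] θx (reversePartition q)
      ≈⟨ ∑-cong (IP xs) regroup ⟩
    ∑[ q ∈ IP xs ] (θ (reversePartition ([ x ] ∷ q)) + joinFirst x (λ p → θ (reversePartition p)) q)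
      ≈⟨ trans (∑-+ (IP xs) _ _) (sym (∑IP-∷ x xs _)) ⟩
    ∑[ p ∈ IP (x ∷ xs) ] θ (reversePartition p) ∎
    where
    θx : List (List _) → Carrier
    θx p = θ (p ++ [ [ x ] ]) + joinLast x θ p
    regroup : ∀ q → θx (reversePartition q) ≈
                    θ (reversePartition ([ x ] ∷ q)) + joinFirst x (λ p → θ (reversePartition p)) q
    regroup []       = refl
    regroup (b ∷ bs) = +-cong
      (reflexive (P.cong θ (P.sym (reversePartition-∷ [ x ] (b ∷ bs)))))
      (begin
        joinLast x θ (reversePartition (b ∷ bs))           ≡⟨ P.cong (joinLast x θ) (reversePartition-∷ b bs) ⟩
        joinLast x θ (reversePartition bs ++ [ reverse b ]) ≈⟨ joinLast-∷ʳ θ x (reversePartition bs) (reverse b) ⟩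
        θ (reversePartition bs ++ [ reverse b ++ [ x ] ])
          ≡⟨ P.cong (λ c → θ (reversePartition bs ++ [ c ])) (P.sym (unfold-reverse x b)) ⟩
        θ (reversePartition bs ++ [ reverse (x ∷ b) ])      ≡⟨ P.cong θ (P.sym (reversePartition-∷ (x ∷ b) bs)) ⟩
        θ (reversePartition ((x ∷ b) ∷ bs))                 ∎)

module ColouredReversal {c ℓ : Level} (R : Ring c ℓ) (N : ℕ) where
  open Ring R hiding (zero)
  open Sums R
  open Reversal R
  open ColouredSums R N
  open import Relation.Binary.Reasoning.Setoid setoid

  ∑wordsOf-∷ʳ : (n : ℕ) (f : Word N → Carrier) →
                ∑ (wordsOf N (suc n)) f ≈ ∑[ w ∈ wordsOf N n ] ∑[ j ∈ allFin N ] f (w ++ [ j ])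
  ∑wordsOf-∷ʳ zero    f =
    trans (∑wordsOf-suc zero f) (trans (∑-cong (allFin N) (λ j → +-identityʳ _)) (sym (+-identityʳ _)))
  ∑wordsOf-∷ʳ (suc n) f = begin
    ∑ (wordsOf N (suc (suc n))) f
      ≈⟨ ∑wordsOf-suc (suc n) f ⟩
    ∑[ j ∈ allFin N ] ∑[ w ∈ wordsOf N (suc n) ] f (j ∷ w)
      ≈⟨ ∑-cong (allFin N) (λ j → ∑wordsOf-∷ʳ n (λ w → f (j ∷ w))) ⟩
    ∑[ j ∈ allFin N ] ∑[ w ∈ wordsOf N n ] ∑[ k ∈ allFin N ] f (j ∷ w ++ [ k ])
      ≈⟨ ∑wordsOf-suc n _ ⟨
    ∑[ w ∈ wordsOf N (suc n) ] ∑[ j ∈ allFin N ] f (w ++ [ j ]) ∎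

  ∑wordsOf-reverse : (n : ℕ) (f : Word N → Carrier) → ∑ (wordsOf N n) f ≈ ∑[ w ∈ wordsOf N n ] f (reverse w)
  ∑wordsOf-reverse zero    f = refl
  ∑wordsOf-reverse (suc n) f = begin
    ∑ (wordsOf N (suc n)) f
      ≈⟨ ∑wordsOf-suc n f ⟩
    ∑[ j ∈ allFin N ] ∑[ w ∈ wordsOf N n ] f (j ∷ w)
      ≈⟨ ∑-cong (allFin N) (λ j → ∑wordsOf-reverse n (λ w → f (j ∷ w))) ⟩
    ∑[ j ∈ allFin N ] ∑[ w ∈ wordsOf N n ] f (j ∷ reverse w)
      ≈⟨ ∑-comm (allFin N) (wordsOf N n) _ ⟩
    ∑[ w ∈ wordsOf N n ] ∑[ j ∈ allFin N ] f (j ∷ reverse w)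
      ≈⟨ ∑-cong (wordsOf N n) (λ w → ∑-cong (allFin N) (λ j → reflexive (P.cong f (P.sym (reverse-++ w [ j ]))))) ⟩
    ∑[ w ∈ wordsOf N n ] ∑[ j ∈ allFin N ] f (reverse (w ++ [ j ]))
      ≈⟨ ∑wordsOf-∷ʳ n _ ⟨
    ∑[ w ∈ wordsOf N (suc n) ] f (reverse w) ∎

  ∑coloured-reverse : (Φ : Word N → List (Word N) → Carrier) (u : Word N) →
                      ∑coloured Φ (reverse u) ≈ ∑coloured (λ w p → Φ (reverse w) (reversePartition p)) u
  ∑coloured-reverse Φ u = trans (∑IP-reverse u _) (∑-cong (intervalPartitions u) λ p →
    trans (reflexive (P.cong (λ k → ∑[ w ∈ wordsOf N k ] Φ w (reversePartition p)) (reversePartition-length p)))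
          (∑wordsOf-reverse (length p) (λ w → Φ w (reversePartition p))))

module PairingHomomorphism {c ℓ : Level} (R : Ring c ℓ) (N : ℕ) (F : Series.Ser R N) where
  open Ring R
  open RingProperties R using (-‿distribˡ-*; -‿distribʳ-*; -‿involutive)
  open Sums R
  open ColouredSums R N using (∏blocks)
  open Series R using (Π'; coeff)
  open Pairing R
  open FreeAlg {N}
  open import Relation.Binary.Reasoning.Setoid setoid

  pairMono-++ : (m m′ : Mono N) → pairMono (m ++ m′) F ≈ pairMono m F * pairMono m′ F
  pairMono-++ m m′ = trans (reflexive (P.cong Π' (map-++ entry m m′))) (Π'-++ (map entry m) (map entry m′))
    where
    entry : Gen N → Carrier
    entry (i , u) = coeff F i u

  pairTerm : Bool × Mono N → Carrier
  pairTerm (s , m) = if s then pairMono m F else - pairMono m F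

  pairTerm-product : ∀ s s′ m m′ → pairTerm (not (s xor s′) , m ++ m′) ≈ pairTerm (s , m) * pairTerm (s′ , m′)
  pairTerm-product true  true  m m′ = pairMono-++ m m′
  pairTerm-product true  false m m′ = trans (-‿cong (pairMono-++ m m′)) (-‿distribʳ-* _ _)
  pairTerm-product false true  m m′ = trans (-‿cong (pairMono-++ m m′)) (-‿distribˡ-* _ _)
  pairTerm-product false false m m′ = begin
    pairMono (m ++ m′) F                ≈⟨ pairMono-++ m m′ ⟩
    pairMono m F * pairMono m′ F        ≈⟨ -‿involutive _ ⟨
    - - (pairMono m F * pairMono m′ F)  ≈⟨ -‿cong (-‿distribˡ-* _ _) ⟩
    - (- pairMono m F * pairMono m′ F)  ≈⟨ -‿distribʳ-* _ _ ⟩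
    - pairMono m F * - pairMono m′ F    ∎

  ⟨⟩-+H : (x y : HElt N) → ⟨ x +H y , F ⟩ ≈ ⟨ x , F ⟩ + ⟨ y , F ⟩
  ⟨⟩-+H x y = ∑-++ x y pairTerm

  ⟨⟩-negH : (x : HElt N) → ⟨ negH x , F ⟩ ≈ - ⟨ x , F ⟩
  ⟨⟩-negH x = trans (∑-map _ x pairTerm)
                    (trans (∑-cong x λ { (true , m) → refl ; (false , m) → sym (-‿involutive _) })
                           (∑-neg x pairTerm))

  ⟨⟩-*H : (a b : HElt N) → ⟨ a *H b , F ⟩ ≈ ⟨ a , F ⟩ * ⟨ b , F ⟩
  ⟨⟩-*H a b = begin
    ⟨ a *H b , F ⟩
      ≈⟨ trans (∑-concatMap _ a pairTerm) (∑-cong a (λ _ → ∑-map _ b pairTerm)) ⟩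
    ∑[ (s , m) ∈ a ] ∑[ (s′ , m′) ∈ b ] pairTerm (not (s xor s′) , m ++ m′)
      ≈⟨ ∑-cong a (λ { (s , m) → ∑-cong b λ { (s′ , m′) → pairTerm-product s s′ m m′ } }) ⟩
    ∑[ t ∈ a ] ∑[ t′ ∈ b ] (pairTerm t * pairTerm t′)
      ≈⟨ ∑-cong a (λ t → *-distribˡ-∑ (pairTerm t) b pairTerm) ⟨
    ∑[ t ∈ a ] (pairTerm t * ∑ b pairTerm)            ≈⟨ *-distribʳ-∑ (∑ b pairTerm) a pairTerm ⟨
    ⟨ a , F ⟩ * ⟨ b , F ⟩                             ∎

  ⟨⟩-oneH : ⟨ oneH , F ⟩ ≈ 1#
  ⟨⟩-oneH = +-identityʳ _

  ⟨⟩-sumH : (xs : List (HElt N)) → ⟨ sumH xs , F ⟩ ≈ ∑[ x ∈ xs ] ⟨ x , F ⟩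
  ⟨⟩-sumH []       = refl
  ⟨⟩-sumH (x ∷ xs) = trans (⟨⟩-+H x (sumH xs)) (+-congˡ (⟨⟩-sumH xs))

  ⟨⟩-Y : (i : Fin N) (u : Word N) → ⟨ Y i u , F ⟩ ≈ coeff F i u
  ⟨⟩-Y i []          = trans (+-identityʳ _) (*-identityʳ _)
  ⟨⟩-Y i (j ∷ []) with does (i ≟ j)
  ... | true  = +-identityʳ _
  ... | false = refl
  ⟨⟩-Y i (j ∷ k ∷ u) = trans (+-identityʳ _) (*-identityʳ _)

  ⟨⟩-ΠH-Y : (v : Word N) (p : List (Word N)) → ⟨ ΠH (zipWith Y v p) , F ⟩ ≈ ∏blocks (coeff F) v p
  ⟨⟩-ΠH-Y []      p       = ⟨⟩-oneH
  ⟨⟩-ΠH-Y (j ∷ v) []      = ⟨⟩-oneH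
  ⟨⟩-ΠH-Y (j ∷ v) (b ∷ p) = trans (⟨⟩-*H (Y j b) _) (*-cong (⟨⟩-Y j b) (⟨⟩-ΠH-Y v p))

  ⟨⟩-SH-gen : (g : Gen N) → ⟨ SH ((true , g ∷ []) ∷ []) , F ⟩ ≈ ⟨ Sgen g , F ⟩
  ⟨⟩-SH-gen g = trans (⟨⟩-+H (oneH *H Sgen g) [])
    (trans (+-identityʳ _) (trans (⟨⟩-*H oneH (Sgen g)) (trans (*-congʳ ⟨⟩-oneH) (*-identityˡ _))))

module AntipodeRecursion {c ℓ : Level} (R : Ring c ℓ) (N : ℕ) (F : Series.Ser R N) where
  open Ring R
  open Sums R
  open ColouredSums R N
  open PairingHomomorphism R N F
  open Series R using (coeff; idSer)
  open Pairing R
  open FreeAlg {N}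
  open import Relation.Binary.Reasoning.Setoid setoid

  ψ : Fin N → Word N → Carrier
  ψ i v = ⟨ Sgen (i , v) , F ⟩

  ⟨SgenF⟩-unfold : (n : ℕ) (i : Fin N) (a b : Fin N) (r : Word N) →
    ⟨ SgenF (suc n) i (a ∷ b ∷ r) , F ⟩ ≈ - coarsePart (coeff F) (λ v → ⟨ SgenF n i v , F ⟩) (a ∷ b ∷ r)
  ⟨SgenF⟩-unfold n i a b r = begin
    ⟨ SgenF (suc n) i u , F ⟩
      ≈⟨ ⟨⟩-negH (sumH (concatMap terms (coarserPartitions u))) ⟩
    - ⟨ sumH (concatMap terms (coarserPartitions u)) , F ⟩
      ≈⟨ -‿cong (trans (⟨⟩-sumH (concatMap terms (coarserPartitions u)))
                       (∑-concatMap terms (coarserPartitions u) (λ x → ⟨ x , F ⟩))) ⟩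
    - ∑[ p ∈ coarserPartitions u ] ∑[ x ∈ terms p ] ⟨ x , F ⟩
      ≈⟨ -‿cong (∑-cong (coarserPartitions u) λ p → trans (∑-map (term p) (wordsOf N (length p)) _)
                   (∑-cong (wordsOf N (length p)) λ v → trans (⟨⟩-*H (ΠH (zipWith Y v p)) (SgenF n i v))
                                                               (*-congʳ (⟨⟩-ΠH-Y v p)))) ⟩
    - coarsePart (coeff F) (λ v → ⟨ SgenF n i v , F ⟩) u ∎
    where
    u : Word N
    u = a ∷ b ∷ r
    term : List (Word N) → Word N → HElt N
    term p v = ΠH (zipWith Y v p) *H SgenF n i v
    terms : List (Word N) → List (HElt N)
    terms p = map (term p) (wordsOf N (length p))

  ⟨SgenF⟩-fuel : (n m : ℕ) (i : Fin N) (v : Word N) → length v ≤ n → length v ≤ m →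
                 ⟨ SgenF n i v , F ⟩ ≈ ⟨ SgenF m i v , F ⟩
  ⟨SgenF⟩-fuel zero    zero    i []       _ _ = refl
  ⟨SgenF⟩-fuel zero    (suc m) i []       _ _ = refl
  ⟨SgenF⟩-fuel (suc n) zero    i []       _ _ = refl
  ⟨SgenF⟩-fuel (suc n) (suc m) i []       _ _ = refl
  ⟨SgenF⟩-fuel n       m       i (j ∷ []) _ _ = refl
  ⟨SgenF⟩-fuel (suc n) (suc m) i u@(a ∷ b ∷ r) (s≤s u≤n) (s≤s u≤m) =
    trans (⟨SgenF⟩-unfold n i a b r) (trans (-‿cong (coarsePart-cong (coeff F) u λ v v<u →
      ⟨SgenF⟩-fuel n m i v (≤-trans (≤-pred v<u) u≤n) (≤-trans (≤-pred v<u) u≤m)))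
      (sym (⟨SgenF⟩-unfold m i a b r)))

  ψ-unfold : (i a b : Fin N) (r : Word N) → ψ i (a ∷ b ∷ r) ≈ - coarsePart (coeff F) (ψ i) (a ∷ b ∷ r)
  ψ-unfold i a b r = trans (⟨SgenF⟩-unfold (suc (length r)) i a b r)
    (-‿cong (coarsePart-cong (coeff F) (a ∷ b ∷ r) λ v v<u → ⟨SgenF⟩-fuel _ (length v) i v (≤-pred v<u) ≤-refl))

  precompose-ψ : (i : Fin N) (u : Word N) → precompose (coeff F) (ψ i) u ≈ coeff idSer i u
  precompose-ψ i []          = precompose-[] (coeff F) (ψ i)
  precompose-ψ i (x ∷ [])    = trans (precompose-leading F (ψ i) (x ∷ [])) (trans (+-identityʳ _) (⟨⟩-Y i (x ∷ [])))
  precompose-ψ i (a ∷ b ∷ r) =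
    trans (precompose-leading F (ψ i) (a ∷ b ∷ r)) (trans (+-congʳ (ψ-unfold i a b r)) (-‿inverseˡ _))

module RightInverse {c ℓ : Level} (R : Ring c ℓ) (N : ℕ) (F : Series.Ser R N) where
  open Ring R
  open Sums R
  open PartitionSums R
  open ColouredSums R N
  open Series R using (coeff; idSer)
  open import Relation.Binary.Reasoning.Setoid setoid

  ∏ʳ : List Carrier → Carrier
  ∏ʳ []       = 1#
  ∏ʳ (a ∷ as) = ∏ʳ as * a

  -- In the opposite ring this is the ordinary substitution h ∘ Y.
  precomposeʳ : (Fin N → Word N → Carrier) → (Word N → Carrier) → Word N → Carrier
  precomposeʳ Y h = ∑coloured (λ w p → ∏ʳ (zipWith Y w p) * h w)

  precomposeʳ-[] : (Y : Fin N → Word N → Carrier) (h : Word N → Carrier) → precomposeʳ Y h [] ≈ h []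
  precomposeʳ-[] Y h = trans (+-identityʳ _) (trans (+-identityʳ _) (*-identityˡ _))

  precomposeʳ-firstBlock : (Y : Fin N → Word N → Carrier) (h : Word N → Carrier) (x : Fin N) (xs : Word N) →
    precomposeʳ Y h (x ∷ xs) ≈
    ∑[ (a , b) ∈ prefixSplits (x ∷ xs) ] ∑[ j ∈ allFin N ] precomposeʳ Y (λ w → Y j a * h (j ∷ w)) b
  precomposeʳ-firstBlock Y h x xs = trans (∑coloured-firstBlock _ x xs)
    (∑-cong (prefixSplits (x ∷ xs)) λ (a , b) → ∑-cong (allFin N) λ j → ∑coloured-cong (λ w p → *-assoc _ _ _) b)

  module _ (Ψ : Fin N → Word N → Carrier) (precompose-Ψ : ∀ j u → precompose (coeff F) (Ψ j) u ≈ coeff idSer j u) where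

    precompose-precomposeʳ : (n : ℕ) (u : Word N) → length u ≤ n → (h : Word N → Carrier) →
                             precompose (coeff F) (precomposeʳ Ψ h) u ≈ h u
    precompose-precomposeʳ n       []       _          h =
      trans (precompose-[] (coeff F) (precomposeʳ Ψ h)) (precomposeʳ-[] Ψ h)
    precompose-precomposeʳ (suc n) (x ∷ xs) (s≤s xs≤n) h = begin
      precompose (coeff F) (precomposeʳ Ψ h) (x ∷ xs)
        ≈⟨ precompose-∷-cong (coeff F) (precomposeʳ-firstBlock Ψ h) x xs ⟩
      precompose (coeff F) (splitSum G) (x ∷ xs)
        ≈⟨ precompose-splitSum (coeff F) (suc n) (x ∷ xs) (s≤s xs≤n) G ⟩
      ∑[ (c , d) ∈ prefixSplits (x ∷ xs) ] precompose (coeff F) (λ a → precompose (coeff F) (G a) d) c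
        ≈⟨ ∑-cong-All (All.map (λ {cd} d<u → cancelLast cd (≤-trans (≤-pred d<u) xs≤n))
                               (prefixSplits-suffix< (x ∷ xs))) ⟩
      ∑[ (c , d) ∈ prefixSplits (x ∷ xs) ] ∑[ j ∈ allFin N ] (coeff idSer j c * h (j ∷ d))
        ≈⟨ ∑prefixSplits-first x xs _ (λ y a b → ∑-zero (allFin N) (λ j → zeroˡ _)) ⟩
      ∑[ j ∈ allFin N ] (coeff idSer j [ x ] * h (j ∷ xs))
        ≈⟨ ∑-δˡ N x (λ j → h (j ∷ xs)) ⟩
      h (x ∷ xs) ∎
      where
      G : Word N → Word N → Carrier
      G a b = ∑[ j ∈ allFin N ] precomposeʳ Ψ (λ w → Ψ j a * h (j ∷ w)) b
      cancelLast : ((c , d) : Word N × Word N) → length d ≤ n →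
        precompose (coeff F) (λ a → precompose (coeff F) (G a) d) c ≈ ∑[ j ∈ allFin N ] (coeff idSer j c * h (j ∷ d))
      cancelLast (c , d) d≤n = begin
        precompose (coeff F) (λ a → precompose (coeff F) (G a) d) c
          ≈⟨ precompose-cong (coeff F) (λ a → trans (precompose-∑ (coeff F) (allFin N) _ d)
                                                   (∑-cong (allFin N) λ j → precompose-precomposeʳ n d d≤n _)) c ⟩
        precompose (coeff F) (λ a → ∑[ j ∈ allFin N ] (Ψ j a * h (j ∷ d))) c
          ≈⟨ trans (precompose-∑ (coeff F) (allFin N) _ c)
                   (∑-cong (allFin N) λ j → precompose-*ʳ (coeff F) (Ψ j) (h (j ∷ d)) c) ⟩
        ∑[ j ∈ allFin N ] (precompose (coeff F) (Ψ j) c * h (j ∷ d))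
          ≈⟨ ∑-cong (allFin N) (λ j → *-congʳ (precompose-Ψ j c)) ⟩
        ∑[ j ∈ allFin N ] (coeff idSer j c * h (j ∷ d)) ∎

    precomposeʳ-coeff : (i : Fin N) (u : Word N) → precomposeʳ Ψ (coeff F i) u ≈ coeff idSer i u
    precomposeʳ-coeff i = precompose-injective F λ u →
      trans (precompose-precomposeʳ (length u) u ≤-refl (coeff F i)) (sym (precompose-idSer F i u))

module OppositeRing {c ℓ : Level} (A : Ring c ℓ) (N : ℕ) (F : Series.Ser A N) where
  Aᵒᵖ : Ring c ℓ
  Aᵒᵖ = Op.ring A

  open Ring A
  open Series A using (Ser; coeff; idSer; _∘ˢ_; _≋_)
  open Pairing A using (⟨_,_⟩; pairMono; leftInvSer; rightInvSer)
  open ColouredSums A N using (∑coloured; ∏blocks; ∑coloured-cong; ∑coloured-cong-length; ∘ˢ-as-∑coloured)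
  open PairingHomomorphism A N F using (pairMono-++; pairTerm)
  open FreeAlg {N}
  module Sᵒᵖ = Series Aᵒᵖ
  module Pᵒᵖ = Pairing Aᵒᵖ
  module Cᵒᵖ = ColouredSums Aᵒᵖ N
  open Sums Aᵒᵖ using () renaming (Π'-++ to Π'ᵒᵖ-++)
  open import Relation.Binary.Reasoning.Setoid setoid

  Fʳ : Ser N
  Fʳ i u = F i (reverse u)

  coeff-ᵒᵖ : (G : Ser N) (i : Fin N) (u : Word N) → coeff G i u ≡ Sᵒᵖ.coeff G i u
  coeff-ᵒᵖ G i []          = P.refl
  coeff-ᵒᵖ G i (j ∷ [])    = P.refl
  coeff-ᵒᵖ G i (j ∷ k ∷ u) = P.refl

  coeff-reverse : (i : Fin N) (u : Word N) → coeff F i (reverse u) ≈ Sᵒᵖ.coeff Fʳ i u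
  coeff-reverse i []          = refl
  coeff-reverse i (j ∷ [])    = refl
  coeff-reverse i u@(a ∷ b ∷ r) =
    reflexive (long (reverse u) (P.subst (2 ≤_) (P.sym (length-reverse u)) (s≤s (s≤s z≤n))))
    where
    long : (v : Word N) → 2 ≤ length v → coeff F i v ≡ F i v
    long (x ∷ y ∷ v) _       = P.refl
    long (x ∷ [])    (s≤s ())

  pairMono-reverse : (F′ : Ser N) (g : Gen N → Gen N) →
    (∀ x → uncurry (coeff F) (g x) ≈ uncurry (Sᵒᵖ.coeff F′) x) →
    (m : Mono N) → pairMono (reverse (map g m)) F ≈ Pᵒᵖ.pairMono m F′
  pairMono-reverse F′ g g≈ []            = refl
  pairMono-reverse F′ g g≈ ((i , u) ∷ m) = begin
    pairMono (reverse (map g ((i , u) ∷ m))) F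
      ≡⟨ P.cong (λ m′ → pairMono m′ F) (unfold-reverse (g (i , u)) (map g m)) ⟩
    pairMono (reverse (map g m) ++ [ g (i , u) ]) F
      ≈⟨ pairMono-++ (reverse (map g m)) [ g (i , u) ] ⟩
    pairMono (reverse (map g m)) F * pairMono [ g (i , u) ] F
      ≈⟨ *-cong (pairMono-reverse F′ g g≈ m) (trans (*-identityʳ _) (g≈ (i , u))) ⟩
    Pᵒᵖ.pairMono ((i , u) ∷ m) F′ ∎

  ⟨⟩-map-ᵒᵖ : (F′ : Ser N) (f : Bool × Mono N → Bool × Mono N) (x : HElt N) →
    (∀ t → pairTerm (f t) ≈ PairingHomomorphism.pairTerm Aᵒᵖ N F′ t) → ⟨ map f x , F ⟩ ≈ Pᵒᵖ.⟨ x , F′ ⟩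
  ⟨⟩-map-ᵒᵖ F′ f x f≈ = trans (Sums.∑-map A f x pairTerm) (Sums.∑-cong A x f≈)

  ⟨⟩-tH : (x : HElt N) → ⟨ tH x , F ⟩ ≈ Pᵒᵖ.⟨ x , F ⟩
  ⟨⟩-tH x = ⟨⟩-map-ᵒᵖ F _ x λ { (true , m) → reverse-pairMono m ; (false , m) → -‿cong (reverse-pairMono m) }
    where
    reverse-pairMono : (m : Mono N) → pairMono (reverse m) F ≈ Pᵒᵖ.pairMono m F
    reverse-pairMono m = trans (reflexive (P.cong (λ m′ → pairMono (reverse m′) F) (P.sym (map-id m))))
                               (pairMono-reverse F (λ g → g) (λ (i , u) → reflexive (coeff-ᵒᵖ F i u)) m)

  ⟨⟩-sH : (x : HElt N) → ⟨ sH x , F ⟩ ≈ Pᵒᵖ.⟨ x , Fʳ ⟩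
  ⟨⟩-sH x = ⟨⟩-map-ᵒᵖ Fʳ _ x λ
    { (true , m)  → pairMono-reverse Fʳ _ (λ (i , u) → coeff-reverse i u) m
    ; (false , m) → -‿cong (pairMono-reverse Fʳ _ (λ (i , u) → coeff-reverse i u) m) }

  open AntipodeRecursion Aᵒᵖ N F using (ψ) renaming (precompose-ψ to precomposeᵒᵖ-ψ)
  open AntipodeRecursion Aᵒᵖ N Fʳ using () renaming (ψ to ψʳ; precompose-ψ to precomposeᵒᵖ-ψʳ)
  open RightInverse Aᵒᵖ N F using (∏ʳ; precomposeʳ; precomposeʳ-coeff)

  rightInvSer-coeff : (j : Fin N) (w : Word N) → coeff (rightInvSer F) j w ≈ ψ j w
  rightInvSer-coeff j []          = refl
  rightInvSer-coeff j (k ∷ [])    = sym (PairingHomomorphism.⟨⟩-Y Aᵒᵖ N F j (k ∷ []))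
  rightInvSer-coeff j (a ∷ b ∷ r) =
    trans (⟨⟩-tH (SH (tH (gen j (a ∷ b ∷ r))))) (PairingHomomorphism.⟨⟩-SH-gen Aᵒᵖ N F (j , a ∷ b ∷ r))

  leftInvSer-coeff : (j : Fin N) (w : Word N) → coeff (leftInvSer F) j w ≈ ψʳ j (reverse w)
  leftInvSer-coeff j []          = refl
  leftInvSer-coeff j (k ∷ [])    = sym (PairingHomomorphism.⟨⟩-Y Aᵒᵖ N Fʳ j (k ∷ []))
  leftInvSer-coeff j (a ∷ b ∷ r) =
    trans (⟨⟩-sH (SH (sH (gen j (a ∷ b ∷ r))))) (PairingHomomorphism.⟨⟩-SH-gen Aᵒᵖ N Fʳ (j , reverse (a ∷ b ∷ r)))

  ∏blocks-∏ʳ : (X Y : Fin N → Word N → Carrier) → (∀ j b → X j b ≈ Y j b) →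
               (w : Word N) (p : List (Word N)) → ∏blocks X w p ≈ ∏ʳ (zipWith Y w p)
  ∏blocks-∏ʳ X Y X≈Y []      p       = refl
  ∏blocks-∏ʳ X Y X≈Y (j ∷ w) []      = refl
  ∏blocks-∏ʳ X Y X≈Y (j ∷ w) (b ∷ p) = *-cong (X≈Y j b) (∏blocks-∏ʳ X Y X≈Y w p)

  ∏blocks-reverse : (w : Word N) (p : List (Word N)) → length w ≡ length p →
    ∏blocks (coeff F) w p ≈ Cᵒᵖ.∏blocks (Sᵒᵖ.coeff Fʳ) (reverse w) (reversePartition p)
  ∏blocks-reverse []      []      _  = refl
  ∏blocks-reverse (j ∷ w) (b ∷ p) eq = sym (begin
    Cᵒᵖ.∏blocks (Sᵒᵖ.coeff Fʳ) (reverse (j ∷ w)) (reversePartition (b ∷ p))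
      ≡⟨ P.cong₂ (Cᵒᵖ.∏blocks (Sᵒᵖ.coeff Fʳ)) (unfold-reverse j w) (reversePartition-∷ b p) ⟩
    Sᵒᵖ.Π' (zipWith (Sᵒᵖ.coeff Fʳ) (reverse w ++ [ j ]) (reversePartition p ++ [ reverse b ]))
      ≡⟨ P.cong Sᵒᵖ.Π' (zipWith-∷ʳ (Sᵒᵖ.coeff Fʳ) (reverse w) (reversePartition p) j (reverse b) lengths) ⟩
    Sᵒᵖ.Π' (zipWith (Sᵒᵖ.coeff Fʳ) (reverse w) (reversePartition p) ++ [ Sᵒᵖ.coeff Fʳ j (reverse b) ])
      ≈⟨ Π'ᵒᵖ-++ (zipWith (Sᵒᵖ.coeff Fʳ) (reverse w) (reversePartition p)) _ ⟩
    (1# * Sᵒᵖ.coeff Fʳ j (reverse b)) * Cᵒᵖ.∏blocks (Sᵒᵖ.coeff Fʳ) (reverse w) (reversePartition p)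
      ≈⟨ *-cong (trans (*-identityˡ _) unreverse) (sym (∏blocks-reverse w p (suc-injective eq))) ⟩
    ∏blocks (coeff F) (j ∷ w) (b ∷ p) ∎)
    where
    lengths : length (reverse w) ≡ length (reversePartition p)
    lengths = P.trans (length-reverse w) (P.trans (suc-injective eq) (P.sym (reversePartition-length p)))
    unreverse : Sᵒᵖ.coeff Fʳ j (reverse b) ≈ coeff F j b
    unreverse = trans (sym (coeff-reverse j (reverse b))) (reflexive (P.cong (coeff F j) (reverse-involutive b)))

  leftInverse : (leftInvSer F ∘ˢ F) ≋ idSer
  leftInverse i u 2≤u = begin
    (leftInvSer F ∘ˢ F) i u
      ≈⟨ ∘ˢ-as-∑coloured (leftInvSer F) F i u ⟩
    ∑coloured (λ w p → coeff (leftInvSer F) i w * ∏blocks (coeff F) w p) u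
      ≈⟨ ∑coloured-cong-length (λ w p w≡p → *-cong (leftInvSer-coeff i w) (∏blocks-reverse w p w≡p)) u ⟩
    ∑coloured (λ w p → ψʳ i (reverse w) * Cᵒᵖ.∏blocks (Sᵒᵖ.coeff Fʳ) (reverse w) (reversePartition p)) u
      ≈⟨ ColouredReversal.∑coloured-reverse Aᵒᵖ N (λ w p → ψʳ i w * Cᵒᵖ.∏blocks (Sᵒᵖ.coeff Fʳ) w p) u ⟨
    Cᵒᵖ.precompose (Sᵒᵖ.coeff Fʳ) (ψʳ i) (reverse u)
      ≈⟨ precomposeᵒᵖ-ψʳ i (reverse u) ⟩
    Sᵒᵖ.coeff Sᵒᵖ.idSer i (reverse u)
      ≈⟨ Cᵒᵖ.coeff-idSer-long i (reverse u) (P.subst (2 ≤_) (P.sym (length-reverse u)) 2≤u) ⟩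
    0# ∎

  rightInverse : (F ∘ˢ rightInvSer F) ≋ idSer
  rightInverse i u 2≤u = begin
    (F ∘ˢ rightInvSer F) i u
      ≈⟨ ∘ˢ-as-∑coloured F (rightInvSer F) i u ⟩
    ∑coloured (λ w p → coeff F i w * ∏blocks (coeff (rightInvSer F)) w p) u
      ≈⟨ ∑coloured-cong (λ w p → *-cong (reflexive (coeff-ᵒᵖ F i w))
                                        (∏blocks-∏ʳ _ ψ rightInvSer-coeff w p)) u ⟩
    precomposeʳ ψ (Sᵒᵖ.coeff F i) u
      ≈⟨ precomposeʳ-coeff ψ precomposeᵒᵖ-ψ i u ⟩
    Sᵒᵖ.coeff Sᵒᵖ.idSer i u
      ≈⟨ Cᵒᵖ.coeff-idSer-long i u 2≤u ⟩
    0# ∎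

theorem14 : {c ℓ : Level} (A : Ring c ℓ) (N : ℕ) (F : Series.Ser A N) →
    Series._≋_ A (Series._∘ˢ_ A (Pairing.leftInvSer A F) F) (Series.idSer A)
    × Series._≋_ A (Series._∘ˢ_ A F (Pairing.rightInvSer A F)) (Series.idSer A)
theorem14 A N F = OppositeRing.leftInverse A N F , OppositeRing.rightInverse A N F
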